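{- Let $F:\mathbb{N}^+\times\mathbb{N}^+\to\mathbb{N}^+$ be defined by $$F(m,n)=\frac{1}{4}\left[(m+n-1)^2-\big((m+n-1)\bmod 2\big)\right]+\min(m,n).$$ For an integer $i\ge 2$ let $S_i=\{(x,y)\in\mathbb{N}^+\times\mathbb{N}^+ : x+y=i,\ x\ge y\}$. If $(x_1,y_1)\in S_i$ and $(x_2,y_2)\in S_{i+1}$, then $F(x_1,y_1)<F(x_2,y_2)$.
   Context: $\mathbb{N}^+$ denotes the set of positive integers. For an integer $k$, $k\bmod 2$ denotes the least non-negative residue of $k$ modulo $2$. -}

module Defs where

open import Data.Nat using (ℕ; _+_; _*_; _∸_; _⊓_; _≤_; _<_)
open import Data.Nat.DivMod using (_/_; _%_)
open import Data.Product using (_×_)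
open import Relation.Binary.PropositionalEquality using (_≡_)

-- F(m,n) = ((m+n-1)^2 - ((m+n-1) mod 2)) / 4 + min(m,n)
-- (the numerator is always divisible by 4, so ℕ division is exact)
F : ℕ → ℕ → ℕ
F m n = let s = m + n ∸ 1 in ((s * s ∸ s % 2) / 4) + (m ⊓ n)

InS : ℕ → ℕ → ℕ → Set
InS i x y = (1 ≤ x) × (1 ≤ y) × (x + y ≡ i) × (y ≤ x)

-- On S_i the value of F is q(i − 1) + y, where q(s) = ⌊s²/4⌋ = ⌊s/2⌋⌈s/2⌉ is the quarter
-- square. Since q(i) = q(i − 1) + ⌊i/2⌋ and every (x, y) ∈ S_i has y ≤ ⌊i/2⌋, every value
-- on S_i is at most q(i), while every value on S_{i+1} is at least q(i) + 1.
module Submission where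

open import Defs
open import Data.List.Base using (_∷_; [])
open import Data.Nat using (ℕ; suc; _+_; _*_; _∸_; _≤_; _<_; s≤s; ⌊_/2⌋; ⌈_/2⌉)
open import Data.Nat.DivMod using (_/_; _%_; m*n/n≡m; m*n%n≡0; [m+kn]%n≡m%n)
open import Data.Nat.Properties
open import Data.Nat.Tactic.RingSolver using (solve)
open import Data.Product using (_,_)
open import Data.Sum using (_⊎_; inj₁; inj₂; map)
open import Relation.Binary.PropositionalEquality

quarterSquare : ℕ → ℕ
quarterSquare s = (s * s ∸ s % 2) / 4

quarterSquare-exact : ∀ s q → s * s ≡ q * 4 + s % 2 → quarterSquare s ≡ q
quarterSquare-exact s q s²≡ = begin
  (s * s ∸ s % 2) / 4          ≡⟨ cong (λ t → (t ∸ s % 2) / 4) s²≡ ⟩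
  (q * 4 + s % 2 ∸ s % 2) / 4  ≡⟨ cong (_/ 4) (m+n∸n≡m (q * 4) (s % 2)) ⟩
  q * 4 / 4                    ≡⟨ m*n/n≡m q 4 ⟩
  q                            ∎
  where open ≡-Reasoning

quarterSquare-even : ∀ h → quarterSquare (h + h) ≡ h * h
quarterSquare-even h = quarterSquare-exact (h + h) (h * h) (begin
  (h + h) * (h + h)        ≡⟨ solve (h ∷ []) ⟩
  h * h * 4 + 0            ≡⟨ cong (h * h * 4 +_) (m*n%n≡0 h 2) ⟨
  h * h * 4 + h * 2 % 2    ≡⟨ cong (λ t → h * h * 4 + t % 2) h*2≡h+h ⟩
  h * h * 4 + (h + h) % 2  ∎)
  where
  open ≡-Reasoning
  h*2≡h+h : h * 2 ≡ h + h
  h*2≡h+h = solve (h ∷ [])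

quarterSquare-odd : ∀ h → quarterSquare (h + suc h) ≡ h * suc h
quarterSquare-odd h = quarterSquare-exact (h + suc h) (h * suc h) (begin
  (h + suc h) * (h + suc h)        ≡⟨ solve (h ∷ []) ⟩
  h * suc h * 4 + 1                ≡⟨ cong (h * suc h * 4 +_) ([m+kn]%n≡m%n 1 h 2) ⟨
  h * suc h * 4 + (1 + h * 2) % 2  ≡⟨ cong (λ t → h * suc h * 4 + t % 2) 1+h*2≡h+1+h ⟩
  h * suc h * 4 + (h + suc h) % 2  ∎)
  where
  open ≡-Reasoning
  1+h*2≡h+1+h : 1 + h * 2 ≡ h + suc h
  1+h*2≡h+1+h = solve (h ∷ [])

⌈n/2⌉≡⌊n/2⌋⊎⌈n/2⌉≡1+⌊n/2⌋ : ∀ n → ⌈ n /2⌉ ≡ ⌊ n /2⌋ ⊎ ⌈ n /2⌉ ≡ suc ⌊ n /2⌋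
⌈n/2⌉≡⌊n/2⌋⊎⌈n/2⌉≡1+⌊n/2⌋ 0             = inj₁ refl
⌈n/2⌉≡⌊n/2⌋⊎⌈n/2⌉≡1+⌊n/2⌋ 1             = inj₂ refl
⌈n/2⌉≡⌊n/2⌋⊎⌈n/2⌉≡1+⌊n/2⌋ (suc (suc n)) =
  map (cong suc) (cong suc) (⌈n/2⌉≡⌊n/2⌋⊎⌈n/2⌉≡1+⌊n/2⌋ n)

quarterSquare≡⌊n/2⌋*⌈n/2⌉ : ∀ s → quarterSquare s ≡ ⌊ s /2⌋ * ⌈ s /2⌉
quarterSquare≡⌊n/2⌋*⌈n/2⌉ s =
  subst (λ t → quarterSquare t ≡ ⌊ s /2⌋ * ⌈ s /2⌉) (⌊n/2⌋+⌈n/2⌉≡n s)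
        (halves (⌈n/2⌉≡⌊n/2⌋⊎⌈n/2⌉≡1+⌊n/2⌋ s))
  where
  halves : ∀ {h c} → c ≡ h ⊎ c ≡ suc h → quarterSquare (h + c) ≡ h * c
  halves {h} (inj₁ refl) = quarterSquare-even h
  halves {h} (inj₂ refl) = quarterSquare-odd h

quarterSquare-suc : ∀ s → quarterSquare (suc s) ≡ quarterSquare s + ⌊ suc s /2⌋
quarterSquare-suc s = begin
  quarterSquare (suc s)           ≡⟨ quarterSquare≡⌊n/2⌋*⌈n/2⌉ (suc s) ⟩
  ⌈ s /2⌉ * suc ⌊ s /2⌋           ≡⟨ *-suc ⌈ s /2⌉ ⌊ s /2⌋ ⟩
  ⌈ s /2⌉ + ⌈ s /2⌉ * ⌊ s /2⌋     ≡⟨ +-comm ⌈ s /2⌉ _ ⟩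
  ⌈ s /2⌉ * ⌊ s /2⌋ + ⌈ s /2⌉     ≡⟨ cong (_+ ⌈ s /2⌉) (*-comm ⌈ s /2⌉ ⌊ s /2⌋) ⟩
  ⌊ s /2⌋ * ⌈ s /2⌉ + ⌈ s /2⌉     ≡⟨ cong (_+ ⌈ s /2⌉) (quarterSquare≡⌊n/2⌋*⌈n/2⌉ s) ⟨
  quarterSquare s + ⌊ suc s /2⌋   ∎
  where open ≡-Reasoning

≤⇒≤⌊+/2⌋ : ∀ {m n} → n ≤ m → n ≤ ⌊ m + n /2⌋
≤⇒≤⌊+/2⌋ {m} {n} n≤m = subst (_≤ ⌊ m + n /2⌋) (sym (n≡⌊n+n/2⌋ n)) (⌊n/2⌋-mono (+-monoˡ-≤ n n≤m))

F-on-S : ∀ {s x y} → InS (suc s) x y → F x y ≡ quarterSquare s + y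
F-on-S (_ , _ , x+y≡ , y≤x) =
  cong₂ (λ t m → quarterSquare (t ∸ 1) + m) x+y≡ (m≥n⇒m⊓n≡n y≤x)

y≤⌊i/2⌋-on-S : ∀ {i x y} → InS i x y → y ≤ ⌊ i /2⌋
y≤⌊i/2⌋-on-S (_ , _ , refl , y≤x) = ≤⇒≤⌊+/2⌋ y≤x

lemma3 : (i x₁ y₁ x₂ y₂ : ℕ) → 2 ≤ i → InS i x₁ y₁ → InS (suc i) x₂ y₂ → F x₁ y₁ < F x₂ y₂
lemma3 (suc s) x₁ y₁ x₂ y₂ (s≤s _) p₁ p₂@(_ , 1≤y₂ , _) = begin-strict
  F x₁ y₁                                  ≡⟨ F-on-S p₁ ⟩
  quarterSquare s + y₁                     ≤⟨ +-monoʳ-≤ (quarterSquare s) (y≤⌊i/2⌋-on-S p₁) ⟩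
  quarterSquare s + ⌊ suc s /2⌋            <⟨ m<m+n _ 1≤y₂ ⟩
  quarterSquare s + ⌊ suc s /2⌋ + y₂       ≡⟨ cong (_+ y₂) (quarterSquare-suc s) ⟨
  quarterSquare (suc s) + y₂               ≡⟨ F-on-S p₂ ⟨
  F x₂ y₂                                  ∎
  where open ≤-Reasoning
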